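{- Fix a mode theory $\mathcal{M}$ (a strict 2-category) and consider the multimodal natural deduction system described in the context. The following lock-weakening rule is admissible: for all pre-contexts $\Gamma,\Delta$, parallel modalities $\mu,\nu : n \to m$, transformation $\alpha : \mu\Rightarrow\nu$, mode $p$ and formula $\varphi$, if $\Gamma.\mathsf{lock}_\mu, \Delta \vdash \varphi\ @\,p$ is derivable, then $\Gamma.\mathsf{lock}_\nu, \Delta \vdash \varphi\ @\,p$ is derivable.
   Context: A mode theory is a strict 2-category $\mathcal{M}$. Its objects are called modes ($m,n,o,p,\dots$); its 1-cells $\mu : n \to m$ are called modalities, with composition $\mu\circ\nu : o \to m$ for $\nu : o\to n$, $\mu : n \to m$, and identities $1_m : m \to m$; its 2-cells $\alpha : \mu \Rightarrow \nu$ (between parallel modalities) are called transformations, with vertical composition $\beta\circ\alpha$, identities $1_\mu$, and horizontal composition $\alpha * \beta : \mu\circ\theta \Rightarrow \nu\circ\xi$ for $\alpha:\mu\Rightarrow\nu$, $\beta : \theta\Rightarrow\xi$, satisfying the strict 2-category laws. Formulas. Pre-formulas: $\varphi,\psi ::= p_i \mid \bot \mid \top \mid \varphi\lor\psi \mid \varphi\land\psi \mid (\mu\mid\varphi)\to\psi \mid \langle\mu\mid\varphi\rangle$. The judgement "$\varphi$ wff $@\,m$" is generated by: $p_i,\top,\bot$ are wff at every mode; if $\varphi,\psi$ wff $@\,m$ then so are $\varphi\land\psi$, $\varphi\lor\psi$; if $\mu:n\to m$, $\varphi$ wff $@\,n$ and $\psi$ wff $@\,m$ then $(\mu\mid\varphi)\to\psi$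 wff $@\,m$; if $\varphi$ wff $@\,n$ and $\mu:n\to m$ then $\langle\mu\mid\varphi\rangle$ wff $@\,m$. Contexts. Pre-contexts: $\Gamma ::= \cdot \mid \Gamma, (\mu\mid\varphi) \mid \Gamma.\mathsf{lock}_\mu$. The judgement "$\Gamma$ ctx $@\,m$" is generated by: $\cdot$ ctx $@\,m$; if $\Gamma$ ctx $@\,m$, $\mu : n\to m$ and $\varphi$ wff $@\,n$ then $\Gamma,(\mu\mid\varphi)$ ctx $@\,m$; if $\Gamma$ ctx $@\,m$ and $\mu : n \to m$ then $\Gamma.\mathsf{lock}_\mu$ ctx $@\,n$. Contexts are identified modulo $\Gamma.\mathsf{lock}_{1_m} = \Gamma$ and $\Gamma.\mathsf{lock}_\mu.\mathsf{lock}_\nu = \Gamma.\mathsf{lock}_{\mu\circ\nu}$. $\Gamma,\Delta$ denotes concatenation of pre-contexts. Define $|\cdot| = 1$, $|\Gamma,(\mu\mid\varphi)| = |\Gamma|$, $|\Gamma.\mathsf{lock}_\mu| = |\Gamma|\circ\mu$. Derivability of $\Gamma\vdash\varphi\ @\,m$ is generated by the rules: (var) if $\mu : n\to m$ and $\alpha : \mu\Rightarrow |\Delta|$ then $\Gamma,(\mu\mid\varphi),\Delta \vdash \varphi\ @\,n$; ($\top$) $\Gamma\vdash\top\ @\,m$; ($\bot$E) from $\Gamma\vdash\bot\ @\,m$ infer $\Gamma\vdash\varphi\ @\,m$; ($\land$I) from $\Gamma\vdash\varphi$ and $\Gamma\vdash\psi$ infer $\Gamma\vdash\varphi\land\psi$;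 ($\land$E) from $\Gamma\vdash\varphi_1\land\varphi_2$ infer $\Gamma\vdash\varphi_i$; ($\lor$I) from $\Gamma\vdash\varphi_i$ infer $\Gamma\vdash\varphi_1\lor\varphi_2$; ($\lor$E) from $\Gamma\vdash\varphi\lor\psi$, $\Gamma,(1\mid\varphi)\vdash C$, $\Gamma,(1\mid\psi)\vdash C$ infer $\Gamma\vdash C$ (all at the same mode); ($\to$I) from $\Gamma,(\mu\mid\varphi)\vdash\psi\ @\,m$ infer $\Gamma\vdash(\mu\mid\varphi)\to\psi\ @\,m$; ($\to$E) if $\mu:n\to m$, from $\Gamma\vdash(\mu\mid\varphi)\to\psi\ @\,m$ and $\Gamma.\mathsf{lock}_\mu\vdash\varphi\ @\,n$ infer $\Gamma\vdash\psi\ @\,m$; (modI) if $\mu:n\to m$, from $\Gamma.\mathsf{lock}_\mu\vdash\varphi\ @\,n$ infer $\Gamma\vdash\langle\mu\mid\varphi\rangle\ @\,m$; (modE) if $\nu:o\to n$, $\mu:n\to m$, from $\Gamma.\mathsf{lock}_\mu\vdash\langle\nu\mid\varphi\rangle\ @\,n$ and $\Gamma,(\mu\circ\nu\mid\varphi)\vdash\psi\ @\,m$ infer $\Gamma\vdash\psi\ @\,m$. A rule is admissible if whenever its premises are derivable, so is its conclusion. -}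

module Defs where

open import Data.Nat using (ℕ)
open import Relation.Binary.PropositionalEquality using (_≡_; subst₂; sym)

record ModeTheory : Set₁ where
  infixr 9 _∘_
  infixr 9 _·_
  infixr 8 _*_
  field
    Mode : Set
    Mod  : Mode → Mode → Set
    1m   : ∀ {m} → Mod m m
    _∘_  : ∀ {o n m} → Mod n m → Mod o n → Mod o m
    ∘-assoc : ∀ {q o n m} (μ : Mod n m) (ν : Mod o n) (ρ : Mod q o) →
              (μ ∘ ν) ∘ ρ ≡ μ ∘ (ν ∘ ρ)
    ∘-idˡ : ∀ {n m} (μ : Mod n m) → 1m ∘ μ ≡ μ
    ∘-idʳ : ∀ {n m} (μ : Mod n m) → μ ∘ 1m ≡ μ

    Two  : ∀ {n m} → Mod n m → Mod n m → Set
    1t   : ∀ {n m} {μ : Mod n m} → Two μ μ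
    _·_  : ∀ {n m} {μ ν ρ : Mod n m} → Two ν ρ → Two μ ν → Two μ ρ
    ·-assoc : ∀ {n m} {μ ν ρ σ : Mod n m} (γ : Two ρ σ) (β : Two ν ρ) (α : Two μ ν) →
              (γ · β) · α ≡ γ · (β · α)
    ·-idˡ : ∀ {n m} {μ ν : Mod n m} (α : Two μ ν) → 1t · α ≡ α
    ·-idʳ : ∀ {n m} {μ ν : Mod n m} (α : Two μ ν) → α · 1t ≡ α
    _*_  : ∀ {o n m} {μ ν : Mod n m} {θ ξ : Mod o n} →
           Two μ ν → Two θ ξ → Two (μ ∘ θ) (ν ∘ ξ)
    *-assoc : ∀ {q o n m} {μ ν : Mod n m} {θ ξ : Mod o n} {ρ σ : Mod q o}
              (α : Two μ ν) (β : Two θ ξ) (γ : Two ρ σ) →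
              subst₂ Two (∘-assoc μ θ ρ) (∘-assoc ν ξ σ) ((α * β) * γ) ≡ α * (β * γ)
    *-idˡ : ∀ {n m} {μ ν : Mod n m} (α : Two μ ν) →
            subst₂ Two (∘-idˡ μ) (∘-idˡ ν) (1t {μ = 1m} * α) ≡ α
    *-idʳ : ∀ {n m} {μ ν : Mod n m} (α : Two μ ν) →
            subst₂ Two (∘-idʳ μ) (∘-idʳ ν) (α * 1t {μ = 1m}) ≡ α
    *-1t  : ∀ {o n m} (μ : Mod n m) (θ : Mod o n) → 1t {μ = μ} * 1t {μ = θ} ≡ 1t
    interchange : ∀ {o n m} {μ ν ρ : Mod n m} {θ ξ ζ : Mod o n}
                  (β : Two ν ρ) (α : Two μ ν) (δ : Two ξ ζ) (γ : Two θ ξ) →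
                  (β · α) * (δ · γ) ≡ (β * δ) · (α * γ)

module Syntax (𝓜 : ModeTheory) where
  open ModeTheory 𝓜

  infixr 6 _∧_
  infixr 5 _∨_
  data Fm : Mode → Set where
    atom : ∀ {m} → ℕ → Fm m
    ⊥f ⊤f : ∀ {m} → Fm m
    _∨_ _∧_ : ∀ {m} → Fm m → Fm m → Fm m
    [_∣_]⇒_ : ∀ {n m} → Mod n m → Fm n → Fm m → Fm m
    ⟨_∣_⟩ : ∀ {n m} → Mod n m → Fm n → Fm m

  data Ctx : Mode → Set where
    ·  : ∀ {m} → Ctx m
    _,[_∣_] : ∀ {n m} → Ctx m → Mod n m → Fm n → Ctx m
    _·lock_ : ∀ {n m} → Ctx m → Mod n m → Ctx n

  -- context extensions (the right-hand part Δ of a concatenation Γ , Δ)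
  -- Tel m n : extends a context at mode m to a context at mode n
  data Tel : Mode → Mode → Set where
    [] : ∀ {m} → Tel m m
    _,[_∣_] : ∀ {m n o} → Tel m n → Mod o n → Fm o → Tel m n
    _·lock_ : ∀ {m n o} → Tel m n → Mod o n → Tel m o

  infixl 4 _++_
  _++_ : ∀ {m n} → Ctx m → Tel m n → Ctx n
  Γ ++ [] = Γ
  Γ ++ (Δ ,[ μ ∣ φ ]) = (Γ ++ Δ) ,[ μ ∣ φ ]
  Γ ++ (Δ ·lock μ) = (Γ ++ Δ) ·lock μ

  ∣_∣ : ∀ {m n} → Tel m n → Mod n m
  ∣ [] ∣ = 1m
  ∣ Δ ,[ _ ∣ _ ] ∣ = ∣ Δ ∣
  ∣ Δ ·lock μ ∣ = ∣ Δ ∣ ∘ μ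

  -- The identification of contexts: the congruence generated by
  --   Γ.lock_1 = Γ   and   Γ.lock_μ.lock_ν = Γ.lock_(μ∘ν)
  infix 3 _≈_
  data _≈_ : ∀ {m} → Ctx m → Ctx m → Set where
    ≈-refl  : ∀ {m} {Γ : Ctx m} → Γ ≈ Γ
    ≈-sym   : ∀ {m} {Γ Γ' : Ctx m} → Γ ≈ Γ' → Γ' ≈ Γ
    ≈-trans : ∀ {m} {Γ Γ' Γ'' : Ctx m} → Γ ≈ Γ' → Γ' ≈ Γ'' → Γ ≈ Γ''
    ≈-ext   : ∀ {n m} {Γ Γ' : Ctx m} (μ : Mod n m) (φ : Fm n) →
              Γ ≈ Γ' → Γ ,[ μ ∣ φ ] ≈ Γ' ,[ μ ∣ φ ]
    ≈-lock  : ∀ {n m} {Γ Γ' : Ctx m} (μ : Mod n m) → Γ ≈ Γ' → Γ ·lock μ ≈ Γ' ·lock μ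
    lock-id : ∀ {m} (Γ : Ctx m) → Γ ·lock 1m ≈ Γ
    lock-∘  : ∀ {o n m} (Γ : Ctx m) (μ : Mod n m) (ν : Mod o n) →
              (Γ ·lock μ) ·lock ν ≈ Γ ·lock (μ ∘ ν)

  -- Derivability  Γ ⊢ φ @ m  (the mode is the index of Γ and φ).
  -- Since contexts are identified modulo _≈_, derivability is closed under _≈_ (rule conv).
  infix 2 _⊢_
  data _⊢_ : ∀ {m} → Ctx m → Fm m → Set where
    conv : ∀ {m} {Γ Γ' : Ctx m} {φ : Fm m} → Γ ≈ Γ' → Γ ⊢ φ → Γ' ⊢ φ
    var  : ∀ {m n} {Γ : Ctx m} {μ : Mod n m} {φ : Fm n} (Δ : Tel m n) →
           Two μ ∣ Δ ∣ → (Γ ,[ μ ∣ φ ]) ++ Δ ⊢ φ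
    ⊤I   : ∀ {m} {Γ : Ctx m} → Γ ⊢ ⊤f
    ⊥E   : ∀ {m} {Γ : Ctx m} {φ : Fm m} → Γ ⊢ ⊥f → Γ ⊢ φ
    ∧I   : ∀ {m} {Γ : Ctx m} {φ ψ : Fm m} → Γ ⊢ φ → Γ ⊢ ψ → Γ ⊢ φ ∧ ψ
    ∧E₁  : ∀ {m} {Γ : Ctx m} {φ ψ : Fm m} → Γ ⊢ φ ∧ ψ → Γ ⊢ φ
    ∧E₂  : ∀ {m} {Γ : Ctx m} {φ ψ : Fm m} → Γ ⊢ φ ∧ ψ → Γ ⊢ ψ
    ∨I₁  : ∀ {m} {Γ : Ctx m} {φ ψ : Fm m} → Γ ⊢ φ → Γ ⊢ φ ∨ ψ
    ∨I₂  : ∀ {m} {Γ : Ctx m} {φ ψ : Fm m} → Γ ⊢ ψ → Γ ⊢ φ ∨ ψ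
    ∨E   : ∀ {m} {Γ : Ctx m} {φ ψ C : Fm m} → Γ ⊢ φ ∨ ψ →
           Γ ,[ 1m ∣ φ ] ⊢ C → Γ ,[ 1m ∣ ψ ] ⊢ C → Γ ⊢ C
    ⇒I   : ∀ {m n} {Γ : Ctx m} {μ : Mod n m} {φ : Fm n} {ψ : Fm m} →
           Γ ,[ μ ∣ φ ] ⊢ ψ → Γ ⊢ [ μ ∣ φ ]⇒ ψ
    ⇒E   : ∀ {m n} {Γ : Ctx m} {μ : Mod n m} {φ : Fm n} {ψ : Fm m} →
           Γ ⊢ [ μ ∣ φ ]⇒ ψ → Γ ·lock μ ⊢ φ → Γ ⊢ ψ
    modI : ∀ {m n} {Γ : Ctx m} {μ : Mod n m} {φ : Fm n} →
           Γ ·lock μ ⊢ φ → Γ ⊢ ⟨ μ ∣ φ ⟩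
    modE : ∀ {m n o} {Γ : Ctx m} {μ : Mod n m} {ν : Mod o n} {φ : Fm o} {ψ : Fm m} →
           Γ ·lock μ ⊢ ⟨ ν ∣ φ ⟩ → Γ ,[ μ ∘ ν ∣ φ ] ⊢ ψ → Γ ⊢ ψ

-- A hypothesis (μ ∣ φ) lying beneath locks whose composite is ρ is usable exactly
-- when there is a transformation μ ⇒ ρ. Derivability therefore depends on a context
-- only through the modalities at which its hypotheses are accessible: if every
-- hypothesis accessible in Γ is accessible in Γ' at the same modality, every
-- derivation over Γ transports to Γ', rule by rule. Identified contexts have the same
-- accessible hypotheses, and replacing lock_μ by lock_ν along α : μ ⇒ ν only whiskers
-- the accessing transformations with α, so it preserves accessibility.
module Submission where

open import Defs
open import Relation.Binary.PropositionalEquality using (_≡_; refl; sym; trans; cong; subst)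

module LockWeakening (𝓜 : ModeTheory) where
  open ModeTheory 𝓜
  open Syntax 𝓜

  infixl 4 _++ᵀ_

  _++ᵀ_ : ∀ {m n o} → Tel m n → Tel n o → Tel m o
  Δ ++ᵀ [] = Δ
  Δ ++ᵀ (E ,[ μ ∣ φ ]) = (Δ ++ᵀ E) ,[ μ ∣ φ ]
  Δ ++ᵀ (E ·lock μ) = (Δ ++ᵀ E) ·lock μ

  ++-assoc : ∀ {m n o} (Γ : Ctx m) (Δ : Tel m n) (E : Tel n o) →
             (Γ ++ (Δ ++ᵀ E)) ≡ ((Γ ++ Δ) ++ E)
  ++-assoc Γ Δ [] = refl
  ++-assoc Γ Δ (E ,[ μ ∣ φ ]) = cong (_,[ μ ∣ φ ]) (++-assoc Γ Δ E)
  ++-assoc Γ Δ (E ·lock μ) = cong (_·lock μ) (++-assoc Γ Δ E)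

  ∣++ᵀ∣ : ∀ {m n o} (Δ : Tel m n) (E : Tel n o) → ∣ Δ ++ᵀ E ∣ ≡ ∣ Δ ∣ ∘ ∣ E ∣
  ∣++ᵀ∣ Δ [] = sym (∘-idʳ _)
  ∣++ᵀ∣ Δ (E ,[ μ ∣ φ ]) = ∣++ᵀ∣ Δ E
  ∣++ᵀ∣ Δ (E ·lock μ) = trans (cong (_∘ μ) (∣++ᵀ∣ Δ E)) (∘-assoc _ _ _)

  -- Var φ Γ ρ : some hypothesis (μ ∣ φ) of Γ comes with a transformation from μ to
  -- the composite of the locks following it in Γ, postcomposed with ρ.
  data Var {k} (φ : Fm k) : ∀ {j} → Ctx j → Mod k j → Set where
    here   : ∀ {j} {Γ : Ctx j} {μ ρ : Mod k j} → Two μ ρ → Var φ (Γ ,[ μ ∣ φ ]) ρ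
    there  : ∀ {j n} {Γ : Ctx j} {μ : Mod n j} {ψ : Fm n} {ρ : Mod k j} →
             Var φ Γ ρ → Var φ (Γ ,[ μ ∣ ψ ]) ρ
    unlock : ∀ {j o} {Γ : Ctx j} {μ : Mod o j} {ρ : Mod k o} →
             Var φ Γ (μ ∘ ρ) → Var φ (Γ ·lock μ) ρ

  Var-mono : ∀ {k j} {φ : Fm k} {Γ : Ctx j} {ρ σ : Mod k j} →
             Var φ Γ ρ → Two ρ σ → Var φ Γ σ
  Var-mono (here α) β = here (_·_ β α)
  Var-mono (there v) β = there (Var-mono v β)
  Var-mono (unlock v) β = unlock (Var-mono v (1t * β))

  Var-++ : ∀ {k j o} {φ : Fm k} {Γ : Ctx j} (Δ : Tel j o) {ρ : Mod k o} →
           Var φ Γ (∣ Δ ∣ ∘ ρ) → Var φ (Γ ++ Δ) ρ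
  Var-++ [] {ρ} v = subst (Var _ _) (∘-idˡ ρ) v
  Var-++ (Δ ,[ μ ∣ φ ]) v = there (Var-++ Δ v)
  Var-++ (Δ ·lock μ) v = unlock (Var-++ Δ (subst (Var _ _) (∘-assoc _ _ _) v))

  Var⇒⊢ : ∀ {k j} {φ : Fm k} {Γ : Ctx j} (Δ : Tel j k) → Var φ Γ ∣ Δ ∣ → Γ ++ Δ ⊢ φ
  Var⇒⊢ Δ (here α) = var Δ α
  Var⇒⊢ {φ = φ} Δ (there {Γ = Γ} {μ} {ψ} v) =
    subst (_⊢ φ) (++-assoc Γ ([] ,[ μ ∣ ψ ]) Δ)
      (Var⇒⊢ ([] ,[ μ ∣ ψ ] ++ᵀ Δ)
        (subst (Var φ Γ) (sym (trans (∣++ᵀ∣ ([] ,[ μ ∣ ψ ]) Δ) (∘-idˡ _))) v))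
  Var⇒⊢ {φ = φ} Δ (unlock {Γ = Γ} {μ} v) =
    subst (_⊢ φ) (++-assoc Γ ([] ·lock μ) Δ)
      (Var⇒⊢ ([] ·lock μ ++ᵀ Δ)
        (subst (Var φ Γ) (sym (trans (∣++ᵀ∣ ([] ·lock μ) Δ) (cong (_∘ ∣ Δ ∣) (∘-idˡ μ)))) v))

  infix 3 _⊆_
  _⊆_ : ∀ {j} → Ctx j → Ctx j → Set
  Γ ⊆ Γ' = ∀ {k} {φ : Fm k} {ρ} → Var φ Γ ρ → Var φ Γ' ρ

  ⊆-ext : ∀ {j n} {Γ Γ' : Ctx j} (μ : Mod n j) (ψ : Fm n) →
          Γ ⊆ Γ' → Γ ,[ μ ∣ ψ ] ⊆ Γ' ,[ μ ∣ ψ ]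
  ⊆-ext μ ψ Γ⊆Γ' (here α) = here α
  ⊆-ext μ ψ Γ⊆Γ' (there v) = there (Γ⊆Γ' v)

  ⊆-lock : ∀ {j n} {Γ Γ' : Ctx j} (μ : Mod n j) → Γ ⊆ Γ' → Γ ·lock μ ⊆ Γ' ·lock μ
  ⊆-lock μ Γ⊆Γ' (unlock v) = unlock (Γ⊆Γ' v)

  ⊆-++ : ∀ {j o} {Γ Γ' : Ctx j} (Δ : Tel j o) → Γ ⊆ Γ' → Γ ++ Δ ⊆ Γ' ++ Δ
  ⊆-++ [] Γ⊆Γ' = Γ⊆Γ'
  ⊆-++ (Δ ,[ μ ∣ ψ ]) Γ⊆Γ' = ⊆-ext μ ψ (⊆-++ Δ Γ⊆Γ')
  ⊆-++ (Δ ·lock μ) Γ⊆Γ' = ⊆-lock μ (⊆-++ Δ Γ⊆Γ')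

  lock-⊆ : ∀ {m n} {Γ : Ctx m} {μ ν : Mod n m} → Two μ ν → Γ ·lock μ ⊆ Γ ·lock ν
  lock-⊆ α (unlock v) = unlock (Var-mono v (α * 1t))

  ≈⇒⊆ : ∀ {j} {Γ Γ' : Ctx j} → Γ ≈ Γ' → Γ ⊆ Γ'
  ≈⇒⊇ : ∀ {j} {Γ Γ' : Ctx j} → Γ ≈ Γ' → Γ' ⊆ Γ

  ≈⇒⊆ ≈-refl v = v
  ≈⇒⊆ (≈-sym e) = ≈⇒⊇ e
  ≈⇒⊆ (≈-trans e f) v = ≈⇒⊆ f (≈⇒⊆ e v)
  ≈⇒⊆ (≈-ext μ φ e) = ⊆-ext μ φ (≈⇒⊆ e)
  ≈⇒⊆ (≈-lock μ e) = ⊆-lock μ (≈⇒⊆ e)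
  ≈⇒⊆ (lock-id Γ) (unlock v) = subst (Var _ _) (∘-idˡ _) v
  ≈⇒⊆ (lock-∘ Γ μ ν) (unlock (unlock v)) = unlock (subst (Var _ _) (sym (∘-assoc _ _ _)) v)

  ≈⇒⊇ ≈-refl v = v
  ≈⇒⊇ (≈-sym e) = ≈⇒⊆ e
  ≈⇒⊇ (≈-trans e f) v = ≈⇒⊇ e (≈⇒⊇ f v)
  ≈⇒⊇ (≈-ext μ φ e) = ⊆-ext μ φ (≈⇒⊇ e)
  ≈⇒⊇ (≈-lock μ e) = ⊆-lock μ (≈⇒⊇ e)
  ≈⇒⊇ (lock-id Γ) v = unlock (subst (Var _ _) (sym (∘-idˡ _)) v)
  ≈⇒⊇ (lock-∘ Γ μ ν) (unlock v) = unlock (unlock (subst (Var _ _) (∘-assoc _ _ _) v))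

  ⊢-⊆ : ∀ {j} {Γ Γ' : Ctx j} {φ : Fm j} → Γ ⊢ φ → Γ ⊆ Γ' → Γ' ⊢ φ
  ⊢-⊆ (conv e d) Γ⊆Γ' = ⊢-⊆ d (λ v → Γ⊆Γ' (≈⇒⊆ e v))
  ⊢-⊆ (var {μ = μ} Δ α) Γ⊆Γ' =
    Var⇒⊢ [] (Γ⊆Γ' (Var-++ Δ (subst (Var _ _) (sym (∘-idʳ _)) (here {μ = μ} α))))
  ⊢-⊆ ⊤I Γ⊆Γ' = ⊤I
  ⊢-⊆ (⊥E d) Γ⊆Γ' = ⊥E (⊢-⊆ d Γ⊆Γ')
  ⊢-⊆ (∧I d e) Γ⊆Γ' = ∧I (⊢-⊆ d Γ⊆Γ') (⊢-⊆ e Γ⊆Γ')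
  ⊢-⊆ (∧E₁ d) Γ⊆Γ' = ∧E₁ (⊢-⊆ d Γ⊆Γ')
  ⊢-⊆ (∧E₂ d) Γ⊆Γ' = ∧E₂ (⊢-⊆ d Γ⊆Γ')
  ⊢-⊆ (∨I₁ d) Γ⊆Γ' = ∨I₁ (⊢-⊆ d Γ⊆Γ')
  ⊢-⊆ (∨I₂ d) Γ⊆Γ' = ∨I₂ (⊢-⊆ d Γ⊆Γ')
  ⊢-⊆ (∨E d e f) Γ⊆Γ' =
    ∨E (⊢-⊆ d Γ⊆Γ') (⊢-⊆ e (⊆-ext _ _ Γ⊆Γ')) (⊢-⊆ f (⊆-ext _ _ Γ⊆Γ'))
  ⊢-⊆ (⇒I d) Γ⊆Γ' = ⇒I (⊢-⊆ d (⊆-ext _ _ Γ⊆Γ'))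
  ⊢-⊆ (⇒E d e) Γ⊆Γ' = ⇒E (⊢-⊆ d Γ⊆Γ') (⊢-⊆ e (⊆-lock _ Γ⊆Γ'))
  ⊢-⊆ (modI d) Γ⊆Γ' = modI (⊢-⊆ d (⊆-lock _ Γ⊆Γ'))
  ⊢-⊆ (modE d e) Γ⊆Γ' = modE (⊢-⊆ d (⊆-lock _ Γ⊆Γ')) (⊢-⊆ e (⊆-ext _ _ Γ⊆Γ'))

theorem2 : (𝓜 : ModeTheory) → let open ModeTheory 𝓜 in let open Syntax 𝓜 in
    ∀ {m n p : Mode} (Γ : Ctx m) (Δ : Tel n p) (μ ν : Mod n m) (α : Two μ ν) (φ : Fm p) →
    (Γ ·lock μ) ++ Δ ⊢ φ → (Γ ·lock ν) ++ Δ ⊢ φ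
theorem2 𝓜 Γ Δ μ ν α φ d = ⊢-⊆ d (⊆-++ Δ (lock-⊆ α))
  where open LockWeakening 𝓜
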